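{- Let $a,b\ge 2$ be integers and let $S_{a,b}$ be a tree of diameter $3$ whose two non-leaf vertices have degrees $a$ and $b$. Then $cfc(S_{a,b})=\Delta(S_{a,b})=\max\{a,b\}$.
   Context: For a connected graph $G$ with an edge-coloring, a path is called conflict-free if some color occurs on exactly one of its edges. The coloring is a conflict-free connection coloring if every pair of distinct vertices is joined by a conflict-free path. The conflict-free connection number $cfc(G)$ is the smallest number of colors in a conflict-free connection coloring of $G$. $\Delta(G)$ denotes the maximum degree. -}

module Defs where

open import Data.Nat using (ℕ; zero; suc; _≤_; _<_; _⊔_)
open import Data.Fin using (Fin; _≟_)
open import Data.Bool using (Bool; true; false; T)
open import Data.List using (List; []; _∷_; length; filter; map; foldr; allFin)
open import Data.List.Relation.Unary.Unique.Propositional using (Unique)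
open import Data.Product using (Σ; _×_; ∃; ∃-syntax)
open import Relation.Binary.PropositionalEquality using (_≡_; _≢_)
open import Relation.Nullary using (¬_)

record Graph (n : ℕ) : Set where
  field
    adj    : Fin n → Fin n → Bool
    sym    : ∀ u v → adj u v ≡ adj v u
    irrefl : ∀ v → adj v v ≡ false

module _ {n : ℕ} (G : Graph n) where
  open Graph G

  Adj : Fin n → Fin n → Set
  Adj u v = T (adj u v)

  degree : Fin n → ℕ
  degree v = length (filter (λ w → Data.Bool._≟_ (adj v w) true) (allFin n))

  maxDegree : ℕ
  maxDegree = foldr _⊔_ 0 (map degree (allFin n))

  data Walk : Fin n → Fin n → Set where
    []  : ∀ {u} → Walk u u
    _∷_ : ∀ {u v w} → Adj u v → Walk v w → Walk u w

  vertices : ∀ {u v} → Walk u v → List (Fin n)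
  vertices {u} []      = u ∷ []
  vertices {u} (_ ∷ p) = u ∷ vertices p

  len : ∀ {u v} → Walk u v → ℕ
  len []      = 0
  len (_ ∷ p) = suc (len p)

  IsPath : ∀ {u v} → Walk u v → Set
  IsPath p = Unique (vertices p)

  Connected : Set
  Connected = ∀ u v → Σ (Walk u v) IsPath

  -- a cycle: a path u … v with at least 2 edges (≥ 3 vertices) closed by an edge v u
  HasCycle : Set
  HasCycle = ∃[ u ] ∃[ v ] Σ (Walk u v) (λ p → IsPath p × 2 ≤ len p × Adj v u)

  IsTree : Set
  IsTree = Connected × ¬ HasCycle

  DistLe : Fin n → Fin n → ℕ → Set
  DistLe u v d = Σ (Walk u v) (λ p → IsPath p × len p ≤ d)

  Diameter : ℕ → Set
  Diameter D = (∀ u v → DistLe u v D)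
             × (∃[ u ] ∃[ v ] (∀ (p : Walk u v) → IsPath p → D ≤ len p))

  -- edge-colourings with k colours (colour of an edge {u,v} is c u v = c v u;
  -- values on non-edges are irrelevant)
  record EdgeColouring (k : ℕ) : Set where
    field
      col     : Fin n → Fin n → Fin k
      col-sym : ∀ u v → col u v ≡ col v u
  open EdgeColouring public

  module _ {k : ℕ} (c : EdgeColouring k) where
    colours : ∀ {u v} → Walk u v → List (Fin k)
    colours []              = []
    colours {u} (_∷_ {v = w} _ p) = col c u w ∷ colours p

    ConflictFree : ∀ {u v} → Walk u v → Set
    ConflictFree p = ∃[ a ] length (filter (_≟ a) (colours p)) ≡ 1

    IsCFCColouring : Set
    IsCFCColouring = ∀ u v → u ≢ v → Σ (Walk u v) (λ p → IsPath p × ConflictFree p)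

  CFCNumber : ℕ → Set
  CFCNumber m = (Σ (EdgeColouring m) IsCFCColouring)
              × (∀ k → k < m → ∀ (c : EdgeColouring k) → ¬ IsCFCColouring c)

module Submission where

-- Lower bound (valid in every forest): if two edges vu, vw at a vertex v
-- share a colour, then u–v–w is the only u–w path, and its colour sequence
-- is (c, c), so it is not conflict-free.  Hence, by pigeonhole, every
-- conflict-free connection colouring of a forest uses at least deg v colours.
--
-- Upper bound (valid in every graph of diameter ≤ 3): in a proper edge
-- colouring every path with at most three edges is conflict-free (its only,
-- first or middle edge has a unique colour).  A double star has a proper
-- colouring with max{a,b} colours: number the edges at x by the position of
-- the other end in the neighbour list of x, do the same at y, and compose
-- the numbering at y with a transposition so the two numberings agree on xy.
--
-- The theorem then only
-- rewrites the centre degrees to a and b.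

open import Defs
open import Data.Nat using (ℕ; suc; _≤_; _<_; _⊔_; z≤n; s≤s)
open import Data.Nat.Properties
  using (≤-trans; ≤-antisym; n≤1+n; ⊔-lub; m≤m⊔n; m≤n⊔m; <⇒≱; ≮⇒≥; <-irrefl)
open import Data.Fin using (Fin; inject≤; fromℕ<)
import Data.Fin as Fin
open import Data.Fin.Properties using (pigeonhole; inject≤-injective)
open import Data.Fin.Permutation.Components using (transpose; transpose-inverse)
open import Data.Bool using (T; true)
open import Data.Bool.Properties using (T-≡)
open import Function.Bundles using (Equivalence)
import Data.Bool as Bool
open import Data.List using (List; []; _∷_; _++_; length; filter; map; foldr; allFin; lookup)
open import Data.List.Properties using (filter-accept; filter-reject)
open import Data.List.Relation.Unary.Any using (here; there; index)
open import Data.List.Relation.Unary.All as All using (All; _∷_)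
open import Data.List.Relation.Unary.All.Properties using (¬Any⇒All¬)
open import Data.List.Relation.Unary.AllPairs using ([]; _∷_)
open import Data.List.Membership.Propositional using (_∈_)
open import Data.List.Membership.Propositional.Properties
  using (∈-filter⁺; ∈-filter⁻; ∈-allFin; ∈-lookup)
import Data.List.Membership.Setoid.Properties as SetoidMembership
import Data.List.Membership.DecPropositional as DecMembership
open import Data.List.Relation.Unary.Unique.Propositional using (Unique)
open import Data.List.Relation.Unary.Unique.Propositional.Properties using (filter⁺; allFin⁺)
open import Data.Product using (Σ; _×_; _,_; proj₁; proj₂; ∃-syntax)
open import Data.Sum using (_⊎_; inj₁; inj₂)
open import Data.Empty using (⊥; ⊥-elim)
open import Relation.Nullary using (¬_; Dec; yes; no)
open import Relation.Nullary.Decidable using (_⊎-dec_)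
open import Relation.Binary.PropositionalEquality

occurrences : ∀ {k} → Fin k → List (Fin k) → ℕ
occurrences a xs = length (filter (Fin._≟ a) xs)

occurrences-here : ∀ {k} (a : Fin k) xs → occurrences a (a ∷ xs) ≡ suc (occurrences a xs)
occurrences-here a xs = cong length (filter-accept (Fin._≟ a) refl)

occurrences-skip : ∀ {k} {a b : Fin k} xs → b ≢ a → occurrences a (b ∷ xs) ≡ occurrences a xs
occurrences-skip xs b≢a = cong length (filter-reject (Fin._≟ _) b≢a)

repeated-not-unique : ∀ {k} (a d : Fin k) → occurrences a (d ∷ d ∷ []) ≢ 1
repeated-not-unique a d eq = by-cases (d Fin.≟ a)
  where
  by-cases : Dec (d ≡ a) → ⊥
  by-cases (yes refl) with () ← trans (sym (trans (occurrences-here d (d ∷ [])) (cong suc (occurrences-here d [])))) eq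
  by-cases (no d≢a)   with () ← trans (sym (trans (occurrences-skip (d ∷ []) d≢a) (occurrences-skip [] d≢a))) eq

member⇒nonempty : ∀ {A : Set} {u : A} {xs : List A} → u ∈ xs → 1 ≤ length xs
member⇒nonempty {xs = _ ∷ _} _ = s≤s z≤n

two-members : ∀ {A : Set} {u w : A} (xs : List A) → u ∈ xs → w ∈ xs → u ≢ w → 2 ≤ length xs
two-members (_ ∷ _)  (here refl) (here refl) u≢w = ⊥-elim (u≢w refl)
two-members (_ ∷ _)  (here refl) (there w∈)  _   = s≤s (member⇒nonempty w∈)
two-members (_ ∷ _)  (there u∈)  (here refl) _   = s≤s (member⇒nonempty u∈)
two-members (_ ∷ xs) (there u∈)  (there w∈)  u≢w = ≤-trans (two-members xs u∈ w∈ u≢w) (n≤1+n _)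

lookup-injective : ∀ {A : Set} {xs : List A} → Unique xs → ∀ i j → lookup xs i ≡ lookup xs j → i ≡ j
lookup-injective {xs = _ ∷ _} _ Fin.zero Fin.zero _ = refl
lookup-injective (x∉ ∷ _) Fin.zero    (Fin.suc j) eq = ⊥-elim (All.lookup x∉ (∈-lookup j) eq)
lookup-injective (x∉ ∷ _) (Fin.suc i) Fin.zero    eq = ⊥-elim (All.lookup x∉ (∈-lookup i) (sym eq))
lookup-injective (_ ∷ u)  (Fin.suc i) (Fin.suc j) eq = cong Fin.suc (lookup-injective u i j eq)

transpose-hits : ∀ {m} (i j : Fin m) → transpose i j j ≡ i
transpose-hits i j with j Fin.≟ i
... | yes j≡i = j≡i
... | no _ with j Fin.≟ j
...   | yes _   = refl
...   | no j≢j  = ⊥-elim (j≢j refl)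

transpose-injective : ∀ {m} (i j : Fin m) {a b : Fin m} → transpose i j a ≡ transpose i j b → a ≡ b
transpose-injective i j {a} {b} eq =
  trans (sym (transpose-inverse j i)) (trans (cong (transpose j i) eq) (transpose-inverse j i))

max-upper : ∀ {A : Set} (f : A → ℕ) {x : A} {xs : List A} → x ∈ xs → f x ≤ foldr _⊔_ 0 (map f xs)
max-upper f (here refl) = m≤m⊔n _ _
max-upper f (there x∈)  = ≤-trans (max-upper f x∈) (m≤n⊔m _ _)

max-least : ∀ {A : Set} (f : A → ℕ) {B : ℕ} (xs : List A) → (∀ x → f x ≤ B) → foldr _⊔_ 0 (map f xs) ≤ B
max-least f []       _     = z≤n
max-least f (x ∷ xs) bound = ⊔-lub (bound x) (max-least f xs bound)

module GraphFacts {n : ℕ} (G : Graph n) where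
  open Graph G using (adj; irrefl) renaming (sym to adj-sym)
  open DecMembership (Fin._≟_ {n}) using (_∈?_)

  neighbours : Fin n → List (Fin n)
  neighbours v = filter (λ w → adj v w Bool.≟ true) (allFin n)

  Adj-sym : ∀ {u v} → Adj G u v → Adj G v u
  Adj-sym {u} {v} = subst T (adj-sym u v)

  Adj-irrefl : ∀ {v} → ¬ Adj G v v
  Adj-irrefl {v} = subst T (irrefl v)

  neighbour⁺ : ∀ {v w} → Adj G v w → w ∈ neighbours v
  neighbour⁺ {v} {w} vw = ∈-filter⁺ (λ w → adj v w Bool.≟ true) (∈-allFin w) (Equivalence.to T-≡ vw)

  neighbour⁻ : ∀ {v w} → w ∈ neighbours v → Adj G v w
  neighbour⁻ {v} w∈ = Equivalence.from T-≡ (proj₂ (∈-filter⁻ (λ w → adj v w Bool.≟ true) {xs = allFin n} w∈))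

  neighbours-unique : ∀ v → Unique (neighbours v)
  neighbours-unique v = filter⁺ (λ w → adj v w Bool.≟ true) (allFin⁺ n)

  branching⇒degree≥2 : ∀ {v u w} → Adj G v u → Adj G v w → u ≢ w → 2 ≤ degree G v
  branching⇒degree≥2 {v} vu vw = two-members (neighbours v) (neighbour⁺ vu) (neighbour⁺ vw)

  start∈ : ∀ {u v} (p : Walk G u v) → u ∈ vertices G p
  start∈ []      = here refl
  start∈ (_ ∷ _) = here refl

  end∈ : ∀ {u v} (p : Walk G u v) → v ∈ vertices G p
  end∈ []      = here refl
  end∈ (_ ∷ p) = there (end∈ p)

  degree≤maxDegree : ∀ v → degree G v ≤ maxDegree G
  degree≤maxDegree v = max-upper (degree G) (∈-allFin v)

  maxDegree-least : ∀ {B} → (∀ v → degree G v ≤ B) → maxDegree G ≤ B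
  maxDegree-least = max-least (degree G) (allFin n)

  module Colouring {k : ℕ} (c : EdgeColouring G k) where

    -- Splitting a walk at one of its vertices; the pieces of a path are
    -- paths (the vertex inclusion is the invariant making the induction work).
    split : ∀ {u v w} (p : Walk G u w) → v ∈ vertices G p →
      Σ (Walk G u v) λ p₁ → Σ (Walk G v w) λ p₂ →
        (colours G c p ≡ colours G c p₁ ++ colours G c p₂) ×
        (IsPath G p → IsPath G p₁ × IsPath G p₂) ×
        (∀ {z} → z ∈ vertices G p₁ → z ∈ vertices G p)
    split []      (here refl) = [] , [] , refl , (λ path → path , path) , λ z∈ → z∈
    split (e ∷ p) (here refl) = [] , e ∷ p , refl , (λ path → (All.[] ∷ []) , path) ,
      λ { (here refl) → here refl }
    split (e ∷ p) (there v∈) with p₁ , p₂ , colours≡ , pieces , p₁⊆p ← split p v∈ =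
      e ∷ p₁ , p₂ , cong (_ ∷_) colours≡ ,
      (λ { (u∉p ∷ path) → (All.tabulate (λ z∈ → All.lookup u∉p (p₁⊆p z∈)) ∷ proj₁ (pieces path)) , proj₂ (pieces path) }) ,
      λ { (here refl) → here refl ; (there z∈) → there (p₁⊆p z∈) }

    path-to-neighbour : ¬ HasCycle G → ∀ {s t} → Adj G t s →
      (p : Walk G s t) → IsPath G p → colours G c p ≡ col c s t ∷ []
    path-to-neighbour _       ts []            _    = ⊥-elim (Adj-irrefl ts)
    path-to-neighbour _       ts (_ ∷ [])      _    = refl
    path-to-neighbour acyclic {s} {t} ts p@(_ ∷ _ ∷ _) path =
      ⊥-elim (acyclic (s , t , p , path , s≤s (s≤s z≤n) , ts))

    path-through-centre : ¬ HasCycle G → ∀ {v u w} → Adj G v u → Adj G v w → u ≢ w →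
      (p : Walk G u w) → IsPath G p → colours G c p ≡ col c u v ∷ col c v w ∷ []
    path-through-centre acyclic {v} vu vw u≢w p path with v ∈? vertices G p
    ... | yes v∈ with p₁ , p₂ , colours≡ , pieces , _ ← split p v∈ =
      trans colours≡ (cong₂ _++_ (path-to-neighbour acyclic vu p₁ (proj₁ (pieces path)))
                                 (path-to-neighbour acyclic (Adj-sym vw) p₂ (proj₂ (pieces path))))
    path-through-centre _ _ _ u≢w [] _ | no _ = ⊥-elim (u≢w refl)
    path-through-centre acyclic {v} {w = w} vu vw u≢w p@(_ ∷ _) path | no v∉p =
      ⊥-elim (acyclic (v , w , vu ∷ p , (¬Any⇒All¬ (vertices G p) v∉p ∷ path) , s≤s (s≤s z≤n) , Adj-sym vw))

    repeated-colour-blocks : ¬ HasCycle G → ∀ {v u w} → Adj G v u → Adj G v w → u ≢ w →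
      col c v u ≡ col c v w → (p : Walk G u w) → IsPath G p → ¬ ConflictFree G c p
    repeated-colour-blocks acyclic {v} {u} {w} vu vw u≢w same p path (a , once) =
      repeated-not-unique a (col c v w) (subst (λ cs → occurrences a cs ≡ 1) colours≡ once)
      where
      colours≡ : colours G c p ≡ col c v w ∷ col c v w ∷ []
      colours≡ = trans (path-through-centre acyclic vu vw u≢w p path)
                       (cong (λ d → d ∷ col c v w ∷ []) (trans (col-sym c u v) same))

    -- Lower bound: a conflict-free connection colouring of a forest has at
    -- least deg v colours, since otherwise two edges at v share a colour.
    cfc⇒degree≤ : ¬ HasCycle G → IsCFCColouring G c → ∀ v → degree G v ≤ k
    cfc⇒degree≤ acyclic cfc v = ≮⇒≥ too-few
      where
      too-few : k < degree G v → ⊥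
      too-few k<d with i , j , i<j , same ← pigeonhole k<d (λ i → col c v (lookup (neighbours v) i)) =
        repeated-colour-blocks acyclic (neighbour⁻ (∈-lookup i)) (neighbour⁻ (∈-lookup j)) u≢w same
          (proj₁ route) (proj₁ (proj₂ route)) (proj₂ (proj₂ route))
        where
        u≢w : lookup (neighbours v) i ≢ lookup (neighbours v) j
        u≢w eq = <-irrefl (cong Fin.toℕ (lookup-injective (neighbours-unique v) i j eq)) i<j
        route = cfc (lookup (neighbours v) i) (lookup (neighbours v) j) u≢w

    Proper : Set
    Proper = ∀ {u v w} → Adj G u v → Adj G v w → u ≢ w → col c u v ≢ col c v w

    -- In a proper colouring every path with at most three edges is
    -- conflict-free: its only edge, its first edge, or its middle edge has a
    -- colour occurring once.
    proper⇒short-path-cf : Proper → ∀ {u v} (p : Walk G u v) → IsPath G p → len G p ≤ 3 → u ≢ v →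
      ConflictFree G c p
    proper⇒short-path-cf _ [] _ _ u≢v = ⊥-elim (u≢v refl)
    proper⇒short-path-cf _ {u} {v} (_ ∷ []) _ _ _ = col c u v , occurrences-here (col c u v) []
    proper⇒short-path-cf proper {u} {v} (_∷_ {v = z} uz (zv ∷ [])) _ _ u≢v =
      col c u z , trans (occurrences-here (col c u z) (col c z v ∷ []))
                       (cong suc (occurrences-skip [] (λ eq → proper uz zv u≢v (sym eq))))
    proper⇒short-path-cf proper {u} {v} (_∷_ {v = z₁} uz₁ (_∷_ {v = z₂} z₁z₂ (z₂v ∷ [])))
                         (u∉ ∷ z₁∉ ∷ _) _ _ =
      col c z₁ z₂ ,
      trans (occurrences-skip (col c z₁ z₂ ∷ col c z₂ v ∷ []) (proper uz₁ z₁z₂ (All.lookup u∉ (there (here refl)))))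
            (trans (occurrences-here (col c z₁ z₂) (col c z₂ v ∷ []))
                   (cong suc (occurrences-skip [] (λ eq → proper z₁z₂ z₂v (All.lookup z₁∉ (there (here refl))) (sym eq)))))
    proper⇒short-path-cf _ (_ ∷ _ ∷ _ ∷ _ ∷ _) _ (s≤s (s≤s (s≤s ()))) _

    proper⇒cfc : Proper → (∀ u v → DistLe G u v 3) → IsCFCColouring G c
    proper⇒cfc proper dist u v u≢v with p , path , short ← dist u v =
      p , path , proper⇒short-path-cf proper p path short u≢v

  open Colouring using (Proper; proper⇒cfc; cfc⇒degree≤)

  module Numbering {m : ℕ} (0<m : 0 < m) where

    number : (v : Fin n) → degree G v ≤ m → Fin n → Fin m
    number v deg≤m w with w ∈? neighbours v
    ... | yes w∈ = inject≤ (index w∈) deg≤m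
    ... | no _   = fromℕ< 0<m

    number-injective : ∀ {v u w} (deg≤m : degree G v ≤ m) → Adj G v u → Adj G v w →
      number v deg≤m u ≡ number v deg≤m w → u ≡ w
    number-injective {v} {u} {w} deg≤m vu vw eq with u ∈? neighbours v | w ∈? neighbours v
    ... | yes u∈ | yes w∈ = SetoidMembership.index-injective (setoid (Fin n)) u∈ w∈
                              (inject≤-injective deg≤m deg≤m _ _ eq)
    ... | no u∉  | _      = ⊥-elim (u∉ (neighbour⁺ vu))
    ... | yes _  | no w∉  = ⊥-elim (w∉ (neighbour⁺ vw))

  module DoubleStar {x y : Fin n} (x≢y : x ≢ y)
                    (leaves : ∀ z → z ≢ x → z ≢ y → degree G z ≤ 1) where

    Centre : Fin n → Set
    Centre v = v ≡ x ⊎ v ≡ y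

    branching⇒centre : ∀ {v u w} → Adj G v u → Adj G v w → u ≢ w → Centre v
    branching⇒centre {v} vu vw u≢w with v Fin.≟ x | v Fin.≟ y
    ... | yes v≡x | _       = inj₁ v≡x
    ... | no _    | yes v≡y = inj₂ v≡y
    ... | no v≢x  | no v≢y  = ⊥-elim (<-irrefl refl (≤-trans (branching⇒degree≥2 vu vw u≢w) (leaves v v≢x v≢y)))

    -- The centres of a connected double star are adjacent: the interior
    -- vertex after x on a longer x–y path would be a third centre.
    centres-adjacent : (p : Walk G x y) → IsPath G p → Adj G x y
    centres-adjacent []        _ = ⊥-elim (x≢y refl)
    centres-adjacent (xy ∷ []) _ = xy
    centres-adjacent (xz₁ ∷ z₁z₂ ∷ q) (x∉ ∷ z₁∉ ∷ _)
      with branching⇒centre (Adj-sym xz₁) z₁z₂ (All.lookup x∉ (there (start∈ q)))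
    ... | inj₁ z₁≡x = ⊥-elim (All.lookup x∉ (here refl) (sym z₁≡x))
    ... | inj₂ z₁≡y = ⊥-elim (All.lookup z₁∉ (end∈ q) z₁≡y)

    module WithEdge (xy : Adj G x y) where

      m : ℕ
      m = degree G x ⊔ degree G y

      0<m : 0 < m
      0<m = ≤-trans (member⇒nonempty (neighbour⁺ xy)) (m≤m⊔n _ _)

      degree≤m : ∀ v → degree G v ≤ m
      degree≤m v with v Fin.≟ x | v Fin.≟ y
      ... | yes refl | _        = m≤m⊔n _ _
      ... | no _     | yes refl = m≤n⊔m _ _
      ... | no v≢x   | no v≢y   = ≤-trans (leaves v v≢x v≢y) 0<m

      Δ-double-star : maxDegree G ≡ m
      Δ-double-star = ≤-antisym (maxDegree-least degree≤m)
                                (⊔-lub (degree≤maxDegree x) (degree≤maxDegree y))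

      open Numbering 0<m

      -- Numberings of the edges at x and at y; the one at y is composed with
      -- a transposition so that both give the edge xy the same colour.
      at-x : Fin n → Fin m
      at-x = number x (m≤m⊔n _ _)

      at-y : Fin n → Fin m
      at-y w = transpose (at-x y) (number y (m≤n⊔m _ _) x) (number y (m≤n⊔m _ _) w)

      at-y-x : at-y x ≡ at-x y
      at-y-x = transpose-hits (at-x y) (number y (m≤n⊔m _ _) x)

      at-y-injective : ∀ {u w} → Adj G y u → Adj G y w → at-y u ≡ at-y w → u ≡ w
      at-y-injective yu yw eq = number-injective (m≤n⊔m _ _) yu yw (transpose-injective _ _ eq)

      from-centre : Fin n → Fin n → Fin m
      from-centre v w with v Fin.≟ y
      ... | yes _ = at-y w
      ... | no _  = at-x w

      from-x : ∀ w → from-centre x w ≡ at-x w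
      from-x w with x Fin.≟ y
      ... | yes x≡y = ⊥-elim (x≢y x≡y)
      ... | no _    = refl

      from-y : ∀ w → from-centre y w ≡ at-y w
      from-y w with y Fin.≟ y
      ... | yes _   = refl
      ... | no y≢y  = ⊥-elim (y≢y refl)

      from-centre-injective : ∀ {v u w} → Centre v → Adj G v u → Adj G v w →
        from-centre v u ≡ from-centre v w → u ≡ w
      from-centre-injective (inj₁ refl) vu vw eq =
        number-injective (m≤m⊔n _ _) vu vw (trans (sym (from-x _)) (trans eq (from-x _)))
      from-centre-injective (inj₂ refl) vu vw eq =
        at-y-injective vu vw (trans (sym (from-y _)) (trans eq (from-y _)))

      from-centre-sym : ∀ {u w} → Centre u → Centre w → from-centre u w ≡ from-centre w u
      from-centre-sym (inj₁ refl) (inj₁ refl) = refl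
      from-centre-sym (inj₂ refl) (inj₂ refl) = refl
      from-centre-sym (inj₁ refl) (inj₂ refl) = trans (from-x y) (trans (sym at-y-x) (sym (from-y x)))
      from-centre-sym (inj₂ refl) (inj₁ refl) = trans (from-y x) (trans at-y-x (sym (from-x y)))

      centre? : ∀ v → Dec (Centre v)
      centre? v = (v Fin.≟ x) ⊎-dec (v Fin.≟ y)

      -- Each edge takes the colour given by a centre endpoint; two leaves are
      -- never adjacent, so the last clause is immaterial.
      colour : Fin n → Fin n → Fin m
      colour u w with centre? u | centre? w
      ... | yes _ | _     = from-centre u w
      ... | no _  | yes _ = from-centre w u
      ... | no _  | no _  = at-x x

      colour-sym : ∀ u w → colour u w ≡ colour w u
      colour-sym u w with centre? u | centre? w
      ... | yes cu | yes cw = from-centre-sym cu cw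
      ... | yes _  | no _   = refl
      ... | no _   | yes _  = refl
      ... | no _   | no _   = refl

      colour-at-centre : ∀ {v} w → Centre v → colour v w ≡ from-centre v w
      colour-at-centre {v} w cv with centre? v
      ... | yes _  = refl
      ... | no ¬cv = ⊥-elim (¬cv cv)

      C : EdgeColouring G m
      C = record { col = colour ; col-sym = colour-sym }

      -- The colouring is proper, as the middle vertex of two adjacent edges
      -- is a centre, where the numbering is injective.
      proper : Proper C
      proper {u} {v} {w} uv vw u≢w same =
        u≢w (from-centre-injective cv (Adj-sym uv) vw (begin
          from-centre v u  ≡⟨ sym (colour-at-centre u cv) ⟩
          colour v u       ≡⟨ colour-sym v u ⟩
          colour u v       ≡⟨ same ⟩
          colour v w       ≡⟨ colour-at-centre w cv ⟩
          from-centre v w  ∎))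
        where
        open ≡-Reasoning
        cv = branching⇒centre (Adj-sym uv) vw u≢w

      cfc-double-star : ¬ HasCycle G → (∀ u v → DistLe G u v 3) → CFCNumber G m
      cfc-double-star acyclic distances =
        (C , proper⇒cfc C proper distances) ,
        λ k k<m c cfc → <⇒≱ k<m (⊔-lub (cfc⇒degree≤ c acyclic cfc x) (cfc⇒degree≤ c acyclic cfc y))

lemma1p6 : (a b : ℕ) → 2 ≤ a → 2 ≤ b → (n : ℕ) → (G : Graph n) →
    IsTree G → Diameter G 3 →
    (∃[ x ] ∃[ y ] (x ≢ y × degree G x ≡ a × degree G y ≡ b ×
      (∀ z → z ≢ x → z ≢ y → degree G z ≤ 1))) →
    CFCNumber G (a ⊔ b) × maxDegree G ≡ a ⊔ b
lemma1p6 a b _ _ n G (connected , acyclic) (distances , _) (x , y , x≢y , deg-x , deg-y , leaves) =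
  subst (CFCNumber G) m≡a⊔b (cfc-double-star acyclic distances) , trans Δ-double-star m≡a⊔b
  where
  open GraphFacts G
  open DoubleStar x≢y leaves
  open WithEdge (centres-adjacent (proj₁ (connected x y)) (proj₂ (connected x y)))
  m≡a⊔b : m ≡ a ⊔ b
  m≡a⊔b = cong₂ _⊔_ deg-x deg-y
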